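{- Let $q$ be a prime power, $n\ge 1$, and let $W$ be an $n$-dimensional affine space over the finite field $\mathbb{F}_q$. Let $A_1,\dots,A_m$ and $B_1,\dots,B_m$ be affine subspaces of $W$ such that $A_i\cap B_i=\emptyset$ for each $1\le i\le m$ and $A_i\cap B_j\neq\emptyset$ whenever $1\le i<j\le m$. Then $$m\le 2\cdot\frac{q^n-1}{q-1}.$$
   Context: An affine subspace of $W$ (identified with $\mathbb{F}_q^n$) is a set of the form $v+V=\{v+x: x\in V\}$ with $v\in W$ and $V$ a linear subspace of $\mathbb{F}_q^n$. No restriction $q\neq 2$ is imposed. -}

module Defs where

open import Level using (0ℓ)
open import Data.Nat using (ℕ; _^_; _≤_)
open import Data.Nat.Primality using (Prime)
open import Data.Fin using (Fin)
open import Data.Product using (Σ; ∃; _×_)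
open import Relation.Nullary using (¬_)
open import Relation.Unary using (Pred)
open import Relation.Binary.PropositionalEquality using (_≡_)
open import Algebra.Bundles using (CommutativeRing)

IsPrimePower : ℕ → Set
IsPrimePower q = Σ ℕ λ p → Σ ℕ λ k → Prime p × (1 ≤ k) × (q ≡ p ^ k)

record IsFieldCR (R : CommutativeRing 0ℓ 0ℓ) : Set where
  open CommutativeRing R
  field
    1≉0     : ¬ (1# ≈ 0#)
    inverse : ∀ x → ¬ (x ≈ 0#) → ∃ λ y → (x * y) ≈ 1#

record FiniteField (q : ℕ) : Set₁ where
  field
    cring   : CommutativeRing 0ℓ 0ℓ
    isField : IsFieldCR cring
  open CommutativeRing cring public
  field
    enum       : Fin q → Carrier
    enum-inj   : ∀ i j → enum i ≈ enum j → i ≡ j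
    enum-surj  : ∀ x → ∃ λ i → enum i ≈ x

module Space {q : ℕ} (F : FiniteField q) (n : ℕ) where
  open FiniteField F

  W : Set
  W = Fin n → Carrier

  _≈W_ : W → W → Set
  u ≈W v = ∀ i → u i ≈ v i

  _+W_ : W → W → W
  (u +W v) i = u i + v i

  _·W_ : Carrier → W → W
  (c ·W v) i = c * v i

  0W : W
  0W i = 0#

  record IsLinearSubspace (V : Pred W 0ℓ) : Set where
    field
      resp  : ∀ {u v} → u ≈W v → V u → V v
      zero∈ : V 0W
      +∈    : ∀ {u v} → V u → V v → V (u +W v)
      ·∈    : ∀ c {v} → V v → V (c ·W v)

  IsAffineSubspace : Pred W 0ℓ → Set₁
  IsAffineSubspace A =
    Σ W λ v → Σ (Pred W 0ℓ) λ V → IsLinearSubspace V ×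
      (∀ x → (A x → ∃ λ y → V y × (x ≈W (v +W y)))
           × ((∃ λ y → V y × (x ≈W (v +W y))) → A x))

{-# OPTIONS --safe #-}
-- Write A = a + U and B = b + V. If A ∩ B = ∅ then a − b ∉ U + V, so some linear
-- functional f vanishes on U + V but not at a − b: f is constant on A and on B, with
-- different values. Up to scaling there are (qⁿ − 1)/(q − 1) nonzero functionals.
-- No f separates three pairs (A_i, B_i), (A_j, B_j), (A_l, B_l) with i < j < l: for
-- x ∈ A_i ∩ B_j, y ∈ A_i ∩ B_l and z ∈ A_j ∩ B_l we get f z = f y = f x, although
-- z ∈ A_j and x ∈ B_j. So each f serves at most two pairs and m ≤ 2(qⁿ − 1)/(q − 1).
--
-- Subspace membership is undecidable, so the separating functionals are only obtained
-- under double negation; this suffices because the inequality is decidable.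
module Submission where

open import Defs
open import Level using (0ℓ)
open import Data.Nat using (ℕ; _^_; _≤_; _<_; _*_; _∸_)
open import Data.Fin using (Fin) renaming (_<_ to _<ᶠ_)
open import Data.Product using (∃; _×_)
open import Relation.Nullary using (¬_)
open import Relation.Unary using (Pred)

open import Data.Nat using (zero; suc)
open import Data.Nat.Properties using (_≤?_)
import Data.Nat.Properties as ℕ
open import Data.Nat.Tactic.RingSolver using (solve-∀)
open import Data.Fin using (zero; suc; combine)
open import Data.Fin.Properties
  using (suc-injective; combine-injective; injective⇒≤; any?; <-cmp; <-trans; sequence)
  renaming (_≟_ to _≟ᶠ_; _<?_ to _<ᶠ?_)
open import Data.Product using (_,_; proj₁; proj₂; map; map₂)
open import Data.Vec.Functional using (_∷_; tail)
open import Data.Empty using (⊥; ⊥-elim)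
open import Function using (_∘_; Injective)
open import Relation.Nullary using (Dec; yes; no; contradiction)
open import Relation.Nullary.Decidable using (decidable-stable; map′; ¬¬-excluded-middle; _×-dec_)
open import Relation.Nullary.Negation using (¬¬-Monad; ¬¬-map)
open import Relation.Unary using (_∩_; Satisfiable)
open import Relation.Binary.Definitions using (tri<; tri≈; tri>)
import Relation.Binary.PropositionalEquality as ≡
open ≡ using (_≡_; refl; cong; module ≡-Reasoning)
open import Effect.Monad using (RawMonad)

open RawMonad (¬¬-Monad {0ℓ}) using (_>>=_; _<$>_; pure; rawApplicative)

geometricSum : ℕ → ℕ → ℕ
geometricSum q zero = 0
geometricSum q (suc n) = suc (geometricSum q n * q)

geometricSum-suc : ∀ k n → suc (geometricSum (suc k) n * k) ≡ suc k ^ n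
geometricSum-suc k zero = refl
geometricSum-suc k (suc n) = begin
  suc (suc (G * suc k) * k)  ≡⟨ horner G k ⟩
  suc k * suc (G * k)        ≡⟨ cong (suc k *_) (geometricSum-suc k n) ⟩
  suc k * suc k ^ n          ∎
  where
  open ≡-Reasoning
  G = geometricSum (suc k) n
  horner : ∀ a k → suc (suc (a * suc k) * k) ≡ suc k * suc (a * k)
  horner = solve-∀

geometricSum-*-pred : ∀ q n → geometricSum q n * (q ∸ 1) ≡ q ^ n ∸ 1
geometricSum-*-pred zero zero = refl
geometricSum-*-pred zero (suc n) = ℕ.*-zeroʳ (geometricSum 0 (suc n))
geometricSum-*-pred (suc k) n = cong (_∸ 1) (geometricSum-suc k n)

m≤geometricSum*2⇒ : ∀ q n {m} → m ≤ geometricSum q n * 2 → m * (q ∸ 1) ≤ 2 * (q ^ n ∸ 1)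
m≤geometricSum*2⇒ q n {m} m≤G*2 = begin
  m * (q ∸ 1)            ≤⟨ ℕ.*-monoˡ-≤ (q ∸ 1) m≤G*2 ⟩
  G * 2 * (q ∸ 1)        ≡⟨ cong (_* (q ∸ 1)) (ℕ.*-comm G 2) ⟩
  2 * G * (q ∸ 1)        ≡⟨ ℕ.*-assoc 2 G (q ∸ 1) ⟩
  2 * (G * (q ∸ 1))      ≡⟨ cong (2 *_) (geometricSum-*-pred q n) ⟩
  2 * (q ^ n ∸ 1)        ∎
  where
  open ℕ.≤-Reasoning
  G = geometricSum q n

flag : {A : Set} → Dec A → Fin 2
flag (yes _) = suc zero
flag (no _) = zero

flag-complete : {A : Set} (a? : Dec A) → A → flag a? ≡ suc zero
flag-complete (yes _) _ = refl
flag-complete (no ¬a) a = contradiction a ¬a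

flag-sound : {A : Set} (a? : Dec A) → flag a? ≡ suc zero → A
flag-sound (yes a) _ = a

module _ {m k : ℕ} (c : Fin m → Fin k) where

  TakesNoValueThrice : Set
  TakesNoValueThrice = ∀ {i j l} → i <ᶠ j → j <ᶠ l → c i ≡ c j → c j ≡ c l → ⊥

  RepeatsEarlier : Fin m → Set
  RepeatsEarlier j = ∃ λ i → i <ᶠ j × c i ≡ c j

  repeatsEarlier? : ∀ j → Dec (RepeatsEarlier j)
  repeatsEarlier? j = any? λ i → (i <ᶠ? j) ×-dec (c i ≟ᶠ c j)

  -- j ↦ (c j, whether c j already occurred) is injective when no value occurs three times.
  noValueThrice⇒≤*2 : TakesNoValueThrice → m ≤ k * 2
  noValueThrice⇒≤*2 noThrice = injective⇒≤ code-injective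
    where
    code : Fin m → Fin (k * 2)
    code j = combine (c j) (flag (repeatsEarlier? j))

    collision : ∀ {i l} → i <ᶠ l → c i ≡ c l →
                flag (repeatsEarlier? i) ≡ flag (repeatsEarlier? l) → ⊥
    collision {i} {l} i<l cᵢ≡cₗ flags≡
      with flag-sound (repeatsEarlier? i)
             (≡.trans flags≡ (flag-complete (repeatsEarlier? l) (i , i<l , cᵢ≡cₗ)))
    ... | h , h<i , cₕ≡cᵢ = noThrice h<i i<l cₕ≡cᵢ cᵢ≡cₗ

    code-injective : Injective _≡_ _≡_ code
    code-injective {i} {l} codes≡ with combine-injective (c i) _ (c l) _ codes≡ | <-cmp i l
    ... | cᵢ≡cₗ , flags≡ | tri< i<l _ _ = ⊥-elim (collision i<l cᵢ≡cₗ flags≡)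
    ... | _              | tri≈ _ i≡l _ = i≡l
    ... | cᵢ≡cₗ , flags≡ | tri> _ _ l<i = ⊥-elim (collision l<i (≡.sym cᵢ≡cₗ) (≡.sym flags≡))

module Separation {q : ℕ} (F : FiniteField q) where

  open FiniteField F hiding (zero; refl) renaming (_*_ to _·_)
  open FiniteField F using () renaming (refl to ≈-refl)
  open module Vectors {n : ℕ} = Space F n
    using (_≈W_; _+W_; _·W_; 0W; IsLinearSubspace; module IsLinearSubspace; IsAffineSubspace)
  open import Algebra.Properties.Ring ring using (-0#≈0#; -1*x≈-x; -‿distribˡ-*)
  open import Algebra.Properties.CommutativeSemigroup +-commutativeSemigroup using (interchange)
  open import Algebra.Properties.CommutativeSemigroup *-commutativeSemigroup
    using () renaming (x∙yz≈y∙xz to ·-leftComm)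
  open import Data.Vec.Functional.Relation.Binary.Equality.Setoid setoid using (≋-sym)

  W : ℕ → Set
  W = Space.W F

  _≈?_ : (x y : Carrier) → Dec (x ≈ y)
  x ≈? y with enum-surj x | enum-surj y
  ... | i , eᵢ≈x | j , eⱼ≈y =
    map′ (λ { refl → trans (sym eᵢ≈x) eⱼ≈y })
         (λ x≈y → enum-inj i j (trans eᵢ≈x (trans x≈y (sym eⱼ≈y))))
         (i ≟ᶠ j)

  index : Carrier → Fin q
  index x = proj₁ (enum-surj x)

  enum-index : ∀ x → enum (index x) ≈ x
  enum-index x = proj₂ (enum-surj x)

  -- The nonzero linear functionals on Fⁿ whose last nonzero coefficient is 1,
  -- one for each linear hyperplane.
  data NormFunctional : ℕ → Set where
    head   : ∀ {n} → NormFunctional (suc n)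
    extend : ∀ {n} → Fin q → NormFunctional n → NormFunctional (suc n)

  eval : ∀ {n} → NormFunctional n → W n → Carrier
  eval head         x = x zero
  eval (extend γ p) x = enum γ · x zero + eval p (tail x)

  toFin : ∀ {n} → NormFunctional n → Fin (geometricSum q n)
  toFin head         = zero
  toFin (extend γ p) = suc (combine (toFin p) γ)

  toFin-injective : ∀ {n} → Injective _≡_ _≡_ (toFin {n})
  toFin-injective {x = head}       {head}         _ = refl
  toFin-injective {x = extend γ p} {extend γ′ p′} e
    with combine-injective (toFin p) γ (toFin p′) γ′ (suc-injective e)
  ... | toFin≡ , refl = cong (extend γ) (toFin-injective toFin≡)

  eval-cong : ∀ {n} (p : NormFunctional n) {x y} → x ≈W y → eval p x ≈ eval p y
  eval-cong head         x≈y = x≈y zero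
  eval-cong (extend γ p) x≈y = +-cong (*-congˡ (x≈y zero)) (eval-cong p (x≈y ∘ suc))

  eval-+ : ∀ {n} (p : NormFunctional n) x y → eval p (x +W y) ≈ eval p x + eval p y
  eval-+ head         x y = ≈-refl
  eval-+ (extend γ p) x y =
    trans (+-cong (distribˡ (enum γ) (x zero) (y zero)) (eval-+ p (tail x) (tail y)))
          (interchange _ _ _ _)

  eval-· : ∀ {n} (p : NormFunctional n) c x → eval p (c ·W x) ≈ c · eval p x
  eval-· head         c x = ≈-refl
  eval-· (extend γ p) c x =
    trans (+-cong (·-leftComm (enum γ) c (x zero)) (eval-· p c (tail x))) (sym (distribˡ c _ _))

  slice : ∀ {n} → Pred (W (suc n)) 0ℓ → Pred (W n) 0ℓ
  slice S z = S (0# ∷ z)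

  slice-isLinear : ∀ {n} {S : Pred (W (suc n)) 0ℓ} → IsLinearSubspace S → IsLinearSubspace (slice S)
  slice-isLinear L = record
    { resp  = λ z≈z′ → resp λ { zero → ≈-refl ; (suc k) → z≈z′ k }
    ; zero∈ = resp (λ { zero → ≈-refl ; (suc _) → ≈-refl }) zero∈
    ; +∈    = λ u∈ v∈ → resp (λ { zero → +-identityʳ 0# ; (suc _) → ≈-refl }) (+∈ u∈ v∈)
    ; ·∈    = λ c v∈ → resp (λ { zero → zeroʳ c ; (suc _) → ≈-refl }) (·∈ c v∈)
    }
    where open IsLinearSubspace L

  ≈0∷tail : ∀ {n} {x : W (suc n)} → x zero ≈ 0# → x ≈W (0# ∷ tail x)
  ≈0∷tail x₀≈0 zero    = x₀≈0
  ≈0∷tail x₀≈0 (suc _) = ≈-refl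

  eliminate : ∀ {n} → W (suc n) → W (suc n) → W (suc n)
  eliminate s x = x +W ((- x zero) ·W s)

  eliminate-head : ∀ {n} (s x : W (suc n)) → s zero ≈ 1# → eliminate s x zero ≈ 0#
  eliminate-head s x s₀≈1 = trans (+-congˡ (trans (*-congˡ s₀≈1) (*-identityʳ _))) (-‿inverseʳ (x zero))

  eliminate-id : ∀ {n} {x : W (suc n)} → x zero ≈ 0# → ∀ s → eliminate s x ≈W x
  eliminate-id x₀≈0 s k =
    trans (+-congˡ (trans (*-congʳ (trans (-‿cong x₀≈0) -0#≈0#)) (zeroˡ (s k)))) (+-identityʳ _)

  eliminate-+ : ∀ {n} (s x : W (suc n)) → (eliminate s x +W (x zero ·W s)) ≈W x
  eliminate-+ s x k = begin
    (x k + (- x zero) · s k) + x zero · s k      ≈⟨ +-assoc (x k) _ _ ⟩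
    x k + ((- x zero) · s k + x zero · s k)      ≈⟨ +-congˡ (+-congʳ (-‿distribˡ-* (x zero) (s k))) ⟨
    x k + (- (x zero · s k) + x zero · s k)      ≈⟨ +-congˡ (-‿inverseˡ _) ⟩
    x k + 0#                                     ≈⟨ +-identityʳ (x k) ⟩
    x k                                          ∎
    where open import Relation.Binary.Reasoning.Setoid setoid

  -‿*-swap : ∀ a b → (- a) · b ≈ (- b) · a
  -‿*-swap a b = trans (sym (-‿distribˡ-* a b)) (trans (-‿cong (*-comm a b)) (-‿distribˡ-* b a))

  liftThrough : ∀ {n} → W (suc n) → NormFunctional n → NormFunctional (suc n)
  liftThrough s p = extend (index (- eval p (tail s))) p

  eval-liftThrough : ∀ {n} s (p : NormFunctional n) x →
                     eval (liftThrough s p) x ≈ eval p (tail (eliminate s x))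
  eval-liftThrough s p x = begin
    enum (index (- P)) · x zero + eval p (tail x)      ≈⟨ +-congʳ (*-congʳ (enum-index (- P))) ⟩
    (- P) · x zero + eval p (tail x)                   ≈⟨ +-comm _ _ ⟩
    eval p (tail x) + (- P) · x zero                   ≈⟨ +-congˡ (-‿*-swap P (x zero)) ⟩
    eval p (tail x) + (- x zero) · P                   ≈⟨ +-congˡ (eval-· p (- x zero) (tail s)) ⟨
    eval p (tail x) + eval p ((- x zero) ·W tail s)    ≈⟨ eval-+ p (tail x) _ ⟨
    eval p (tail (eliminate s x))                      ∎
    where
    open import Relation.Binary.Reasoning.Setoid setoid
    P = eval p (tail s)

  Separates : ∀ {n} → NormFunctional n → Pred (W n) 0ℓ → W n → Set
  Separates p S w = (∀ {t} → S t → eval p t ≈ 0#) × ¬ eval p w ≈ 0#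

  Separable : ∀ {n} → Pred (W n) 0ℓ → W n → Set
  Separable S w = ∃ λ p → Separates p S w

  liftThrough-separates : ∀ {n} {S : Pred (W (suc n)) 0ℓ} s {w p} → IsLinearSubspace S →
                          s zero ≈ 1# → (∀ {t} → S t → S (eliminate s t)) →
                          Separates p (slice S) (tail (eliminate s w)) → Separates (liftThrough s p) S w
  liftThrough-separates s {w} {p} L s₀≈1 closed (vanishes , nonzero) =
      (λ {t} t∈S → trans (eval-liftThrough s p t)
                         (vanishes (resp (≈0∷tail (eliminate-head s t s₀≈1)) (closed t∈S))))
    , (λ pw≈0 → nonzero (trans (sym (eval-liftThrough s p w)) pw≈0))
    where open IsLinearSubspace L

  separate : ∀ {n} {S : Pred (W n) 0ℓ} → IsLinearSubspace S → ∀ {w} → ¬ S w → ¬ ¬ Separable S w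
  separate {zero} L w∉S = contradiction (resp (λ ()) zero∈) w∉S
    where open IsLinearSubspace L
  separate {suc n} {S} L {w} w∉S = ¬¬-excluded-middle {A = ∃ λ s → S s × ¬ s zero ≈ 0#} >>= λ where
      (yes (s , s∈S , s₀≉0)) → throughPivot s∈S s₀≉0
      (no noPivot) → insideHyperplane
        (λ t∈S → decidable-stable (_ ≈? 0#) (λ t₀≉0 → noPivot (_ , t∈S , t₀≉0)))
        (w zero ≈? 0#)
    where
    open IsLinearSubspace L

    eliminating : ∀ {s} → s zero ≈ 1# → (∀ {t} → S t → S (eliminate s t)) → ¬ S (eliminate s w) →
                  ¬ ¬ Separable S w
    eliminating {s} s₀≈1 closed sw∉S =
      ¬¬-map (map (liftThrough s) λ {p} → liftThrough-separates s {w} {p} L s₀≈1 closed)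
             (separate (slice-isLinear L) (sw∉S ∘ resp (≋-sym (≈0∷tail (eliminate-head s w s₀≈1)))))

    throughPivot : ∀ {s} → S s → ¬ s zero ≈ 0# → ¬ ¬ Separable S w
    throughPivot {s} s∈S s₀≉0 with IsFieldCR.inverse isField (s zero) s₀≉0
    ... | s₀⁻¹ , s₀s₀⁻¹≈1 =
      eliminating s′₀≈1 (λ t∈S → +∈ t∈S (·∈ _ s′∈S))
                  (λ sw∈S → w∉S (resp (eliminate-+ s′ w) (+∈ sw∈S (·∈ (w zero) s′∈S))))
      where
      s′ = s₀⁻¹ ·W s
      s′∈S = ·∈ s₀⁻¹ s∈S
      s′₀≈1 = trans (*-comm s₀⁻¹ (s zero)) s₀s₀⁻¹≈1

    insideHyperplane : (∀ {t} → S t → t zero ≈ 0#) → Dec (w zero ≈ 0#) → ¬ ¬ Separable S w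
    insideHyperplane flat (no w₀≉0) = pure (head , (λ {_} → flat) , w₀≉0)
    insideHyperplane flat (yes w₀≈0) =
      eliminating {1# ∷ 0W} ≈-refl (λ t∈S → resp (≋-sym (eliminate-id (flat t∈S) _)) t∈S)
                  (w∉S ∘ resp (eliminate-id w₀≈0 _))

  ConstantOn : ∀ {n} → NormFunctional n → Pred (W n) 0ℓ → Set
  ConstantOn p A = ∀ {x y} → A x → A y → eval p x ≈ eval p y

  SeparatesAffine : ∀ {n} → NormFunctional n → Pred (W n) 0ℓ → Pred (W n) 0ℓ → Set
  SeparatesAffine p A B = ConstantOn p A × ConstantOn p B × (∀ {x y} → A x → B y → ¬ eval p x ≈ eval p y)

  noThreefoldSeparator :
    ∀ {n} {p : NormFunctional n} {A₁ B₁ A₂ B₂ A₃ B₃} →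
    SeparatesAffine p A₁ B₁ → SeparatesAffine p A₂ B₂ → SeparatesAffine p A₃ B₃ →
    Satisfiable (A₁ ∩ B₂) → Satisfiable (A₁ ∩ B₃) → Satisfiable (A₂ ∩ B₃) → ⊥
  noThreefoldSeparator (A₁-constant , _) (_ , _ , A₂≉B₂) (_ , B₃-constant , _)
                       (x , x∈A₁ , x∈B₂) (y , y∈A₁ , y∈B₃) (z , z∈A₂ , z∈B₃) =
    A₂≉B₂ z∈A₂ x∈B₂ (trans (B₃-constant z∈B₃ y∈B₃) (A₁-constant y∈A₁ x∈A₁))

  _+ₛ_ : ∀ {n} → Pred (W n) 0ℓ → Pred (W n) 0ℓ → Pred (W n) 0ℓ
  (U +ₛ V) z = ∃ λ u → ∃ λ v → U u × V v × z ≈W (u +W v)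

  +ₛ-isLinear : ∀ {n} {U V : Pred (W n) 0ℓ} →
                IsLinearSubspace U → IsLinearSubspace V → IsLinearSubspace (U +ₛ V)
  +ₛ-isLinear U-linear V-linear = record
    { resp  = λ { z≈z′ (u , v , u∈U , v∈V , z≈u+v) →
                  u , v , u∈U , v∈V , λ k → trans (sym (z≈z′ k)) (z≈u+v k) }
    ; zero∈ = 0W , 0W , U.zero∈ , V.zero∈ , λ _ → sym (+-identityʳ 0#)
    ; +∈    = λ { (u , v , u∈U , v∈V , z≈u+v) (u′ , v′ , u′∈U , v′∈V , z′≈u′+v′) →
                  (u +W u′) , (v +W v′) , U.+∈ u∈U u′∈U , V.+∈ v∈V v′∈V ,
                  λ k → trans (+-cong (z≈u+v k) (z′≈u′+v′ k)) (interchange (u k) (v k) (u′ k) (v′ k)) }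
    ; ·∈    = λ { c (u , v , u∈U , v∈V , z≈u+v) →
                  (c ·W u) , (c ·W v) , U.·∈ c u∈U , V.·∈ c v∈V ,
                  λ k → trans (*-congˡ (z≈u+v k)) (distribˡ c (u k) (v k)) }
    }
    where
    module U = IsLinearSubspace U-linear
    module V = IsLinearSubspace V-linear

  eval-onCoset : ∀ {n} (p : NormFunctional n) {U : Pred (W n) 0ℓ} {a x y} →
                 (∀ {t} → U t → eval p t ≈ 0#) → U y → x ≈W (a +W y) → eval p x ≈ eval p a
  eval-onCoset p vanishes y∈U x≈a+y =
    trans (eval-cong p x≈a+y) (trans (eval-+ p _ _) (trans (+-congˡ (vanishes y∈U)) (+-identityʳ _)))

  x+-1·x≈0 : ∀ x → x + (- 1#) · x ≈ 0#
  x+-1·x≈0 x = trans (+-congˡ (-1*x≈-x x)) (-‿inverseʳ x)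

  difference-swap : ∀ {a b u v} → a + (- 1#) · b ≈ u + v → b + v ≈ a + (- 1#) · u
  difference-swap {a} {b} {u} {v} a-b≈u+v = begin
    b + v                                  ≈⟨ +-identityʳ _ ⟨
    (b + v) + 0#                           ≈⟨ +-congˡ (x+-1·x≈0 u) ⟨
    (b + v) + (u + (- 1#) · u)             ≈⟨ exchange b v u _ ⟩
    (u + v) + (b + (- 1#) · u)             ≈⟨ +-congʳ a-b≈u+v ⟨
    (a + (- 1#) · b) + (b + (- 1#) · u)    ≈⟨ exchange a _ b _ ⟩
    (b + (- 1#) · b) + (a + (- 1#) · u)    ≈⟨ +-congʳ (x+-1·x≈0 b) ⟩
    0# + (a + (- 1#) · u)                  ≈⟨ +-identityˡ _ ⟩
    a + (- 1#) · u                         ∎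
    where
    open import Relation.Binary.Reasoning.Setoid setoid
    exchange : ∀ x y z t → (x + y) + (z + t) ≈ (z + y) + (x + t)
    exchange x y z t = trans (interchange x y z t) (trans (+-congʳ (+-comm x z)) (interchange z x y t))

  disjoint-separable : ∀ {n} {A B : Pred (W n) 0ℓ} → IsAffineSubspace A → IsAffineSubspace B →
                       ¬ Satisfiable (A ∩ B) → ¬ ¬ ∃ λ p → SeparatesAffine p A B
  disjoint-separable {A = A} {B} (a , U , U-linear , A≈a+U) (b , V , V-linear , B≈b+V) A∩B=∅ =
    ¬¬-map (map₂ λ {p} → separatesAffine {p}) (separate (+ₛ-isLinear U-linear V-linear) a-b∉U+V)
    where
    module U = IsLinearSubspace U-linear
    module V = IsLinearSubspace V-linear

    inU : ∀ {t} → U t → (U +ₛ V) t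
    inU t∈U = _ , 0W , t∈U , V.zero∈ , λ _ → sym (+-identityʳ _)

    inV : ∀ {t} → V t → (U +ₛ V) t
    inV t∈V = 0W , _ , U.zero∈ , t∈V , λ _ → sym (+-identityˡ _)

    a-b : W _
    a-b = a +W ((- 1#) ·W b)

    a-b∉U+V : ¬ (U +ₛ V) a-b
    a-b∉U+V (u , v , u∈U , v∈V , a-b≈u+v) =
      A∩B=∅ ( b +W v
            , proj₂ (A≈a+U _) ((- 1#) ·W u , U.·∈ (- 1#) u∈U , λ k → difference-swap (a-b≈u+v k))
            , proj₂ (B≈b+V _) (v , v∈V , λ _ → ≈-refl))

    separatesAffine : ∀ {p} → Separates p (U +ₛ V) a-b → SeparatesAffine p A B
    separatesAffine {p} (vanishes , a-b≉0) =
      (λ x∈A y∈A → trans (onA x∈A) (sym (onA y∈A))) ,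
      (λ x∈B y∈B → trans (onB x∈B) (sym (onB y∈B))) ,
      (λ x∈A y∈B px≈py → a-b≉0 (pa≈pb⇒ (trans (sym (onA x∈A)) (trans px≈py (onB y∈B)))))
      where
      onA : ∀ {x} → A x → eval p x ≈ eval p a
      onA x∈A with proj₁ (A≈a+U _) x∈A
      ... | y , y∈U , x≈a+y = eval-onCoset p (vanishes ∘ inU) y∈U x≈a+y

      onB : ∀ {x} → B x → eval p x ≈ eval p b
      onB x∈B with proj₁ (B≈b+V _) x∈B
      ... | y , y∈V , x≈b+y = eval-onCoset p (vanishes ∘ inV) y∈V x≈b+y

      pa≈pb⇒ : eval p a ≈ eval p b → eval p a-b ≈ 0#
      pa≈pb⇒ pa≈pb =
        trans (eval-+ p a _) (trans (+-cong pa≈pb (eval-· p (- 1#) b)) (x+-1·x≈0 (eval p b)))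

  separatorCodes-takeNoValueThrice :
    ∀ {n m} {A B : Fin m → Pred (W n) 0ℓ} → (∀ i j → i <ᶠ j → Satisfiable (A i ∩ B j)) →
    (separators : ∀ i → ∃ λ p → SeparatesAffine p (A i) (B i)) →
    TakesNoValueThrice (toFin ∘ proj₁ ∘ separators)
  separatorCodes-takeNoValueThrice {A = A} {B} meet separators {i} {j} {l} i<j j<l cᵢ≡cⱼ cⱼ≡cₗ =
    noThreefoldSeparator {p = proj₁ (separators j)}
      (≡.subst (λ p → SeparatesAffine p (A i) (B i)) (toFin-injective cᵢ≡cⱼ) (proj₂ (separators i)))
      (proj₂ (separators j))
      (≡.subst (λ p → SeparatesAffine p (A l) (B l)) (≡.sym (toFin-injective cⱼ≡cₗ))
               (proj₂ (separators l)))
      (meet i j i<j) (meet i l (<-trans i<j j<l)) (meet j l j<l)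

theorem2p1 : (q : ℕ) → IsPrimePower q → (F : FiniteField q) → (n : ℕ) → 1 ≤ n →
    (m : ℕ) → (A B : Fin m → Pred (Space.W F n) 0ℓ) →
    (∀ i → Space.IsAffineSubspace F n (A i)) →
    (∀ i → Space.IsAffineSubspace F n (B i)) →
    (∀ i → ¬ (∃ λ x → A i x × B i x)) →
    (∀ i j → i <ᶠ j → ∃ λ x → A i x × B j x) →
    m * (q ∸ 1) ≤ 2 * (q ^ n ∸ 1)
theorem2p1 q _ F n _ m A B A-affine B-affine disjoint meet =
  decidable-stable (m * (q ∸ 1) ≤? 2 * (q ^ n ∸ 1)) (bound <$> sequence rawApplicative separators)
  where
  open Separation F

  separators : ∀ i → ¬ ¬ ∃ λ p → SeparatesAffine p (A i) (B i)
  separators i = disjoint-separable (A-affine i) (B-affine i) (disjoint i)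

  bound : (∀ i → ∃ λ p → SeparatesAffine p (A i) (B i)) → m * (q ∸ 1) ≤ 2 * (q ^ n ∸ 1)
  bound chosen =
    m≤geometricSum*2⇒ q n (noValueThrice⇒≤*2 _ (separatorCodes-takeNoValueThrice meet chosen))
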